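{- Let $w=[0;a_1,a_2,\ldots]$ be a continued fraction with all $a_i\in\{1,2\}$, and suppose the sequence $(a_1,a_2,\ldots)$ does not contain $(2,1,2,1)$ as a block of consecutive terms. Then $w\ge w_0$, where $w_0=[0;\overline{2,1,2,2}]$.
   Context: The overline denotes an infinitely repeated period. -}

module Defs where

open import Data.Nat using (ℕ; zero; suc; _+_; _*_; _≤_; _%_)
open import Data.Product using (∃-syntax; _×_)
open import Data.Sum using (_⊎_)
open import Relation.Binary.PropositionalEquality using (_≡_)
open import Relation.Nullary using (¬_)

-- An infinite continued fraction [0; a₁, a₂, …] is given by its digit
-- sequence, 0-indexed:  a i  is the partial quotient  a_{i+1}.
Digits : Set
Digits = ℕ → ℕ

-- Numerators / denominators of the convergents  p n / q n = [0; a₁, …, aₙ]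
-- by the standard recurrence
--   p₋₁ = 1, p₀ = 0,  q₋₁ = 0, q₀ = 1,
--   pₙ = aₙ pₙ₋₁ + pₙ₋₂,  qₙ = aₙ qₙ₋₁ + qₙ₋₂.
num : Digits → ℕ → ℕ
num a zero = 0
num a (suc zero) = 1
num a (suc (suc n)) = a (suc n) * num a (suc n) + num a n

den : Digits → ℕ → ℕ
den a zero = 1
den a (suc zero) = a 0
den a (suc (suc n)) = a (suc n) * den a (suc n) + den a n

-- The value of a continued fraction is the limit of its convergents
-- (a real number given by a Cauchy sequence of rationals).  For two such
-- reals  x = lim pₙ/qₙ  and  y = lim p'ₙ/q'ₙ  the order  x ≥ y  is, by
-- definition of the order on Cauchy reals:
--   for every k, eventually  p'ₙ/q'ₙ ≤ pₙ/qₙ + 1/(k+1),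
-- written out with denominators cleared (all denominators are positive
-- for digit sequences with positive entries).
_≥ᶜᶠ_ : Digits → Digits → Set
a ≥ᶜᶠ b = ∀ (k : ℕ) → ∃[ N ] ∀ (n : ℕ) → N ≤ n →
  num b n * den a n * suc k ≤ (num a n * suc k + den a n) * den b n

OnlyOnesTwos : Digits → Set
OnlyOnesTwos a = ∀ i → a i ≡ 1 ⊎ a i ≡ 2

Contains2121 : Digits → Set
Contains2121 a = ∃[ i ] (a i ≡ 2 × a (suc i) ≡ 1 × a (suc (suc i)) ≡ 2 × a (suc (suc (suc i))) ≡ 1)

w₀ : Digits
w₀ i with i % 4
... | 1 = 1
... | _ = 2

{-# OPTIONS --safe #-}
-- Compare the n-th convergents of a and of w₀ = [0; 2,1,2,2, 2,1,2,2, …]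
-- digit by digit.  Since [0; a₀, a₁, …] = 1 / (a₀ + [0; a₁, …]), a smaller
-- leading digit gives a larger value, while equal leading digits reverse the
-- comparison of the tails.  Walking along the period 2,1,2,2 in lockstep with
-- a, at each place a digit of a from {1,2} either equals that of w₀ or
-- deviates in the direction that makes a larger; the one exception is a 1 in
-- the fourth place after 2,1,2, which would create the block 2,1,2,1.  Hence
-- every convergent of a dominates the corresponding convergent of w₀.
module Submission where

open import Defs
open import Data.Nat using (ℕ; zero; suc; _+_; _*_; _≤_; _<_; z≤n; s≤s)
open import Data.Nat.Properties
open import Algebra.Properties.CommutativeSemigroup *-commutativeSemigroup
  using (xy∙z≈xz∙y)
open import Data.Nat.Tactic.RingSolver using (solve-∀)
open import Data.Product using (_,_)
open import Data.Sum using (_⊎_; inj₁; inj₂)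
open import Function using (_∘_)
open import Relation.Binary.PropositionalEquality
open import Relation.Nullary using (¬_; contradiction)

tail : Digits → Digits
tail a i = a (suc i)

num-suc : ∀ a n → num a (suc n) ≡ den (tail a) n
num-suc a zero = refl
num-suc a (suc zero) = trans (+-identityʳ (a 1 * 1)) (*-identityʳ (a 1))
num-suc a (suc (suc n)) =
  cong₂ (λ x y → a (suc (suc n)) * x + y) (num-suc a (suc n)) (num-suc a n)

den-suc : ∀ a n → den a (suc n) ≡ a 0 * den (tail a) n + num (tail a) n
den-suc a zero = sym (trans (+-identityʳ (a 0 * 1)) (*-identityʳ (a 0)))
den-suc a (suc zero) = cong (_+ 1) (*-comm (a 1) (a 0))
den-suc a (suc (suc n)) = begin
  c * den a (suc (suc n)) + den a (suc n)
    ≡⟨ cong₂ (λ x y → c * x + y) (den-suc a (suc n)) (den-suc a n) ⟩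
  c * (a 0 * D₁ + N₁) + (a 0 * D₀ + N₀)
    ≡⟨ regroup c (a 0) D₁ N₁ D₀ N₀ ⟩
  a 0 * (c * D₁ + D₀) + (c * N₁ + N₀) ∎
  where
  open ≡-Reasoning
  c D₁ N₁ D₀ N₀ : ℕ
  c = a (suc (suc n))
  D₁ = den (tail a) (suc n)
  N₁ = num (tail a) (suc n)
  D₀ = den (tail a) n
  N₀ = num (tail a) n
  regroup : ∀ c a₀ D₁ N₁ D₀ N₀ →
    c * (a₀ * D₁ + N₁) + (a₀ * D₀ + N₀) ≡ a₀ * (c * D₁ + D₀) + (c * N₁ + N₀)
  regroup = solve-∀

num≤den : ∀ {a} → 1 ≤ a 0 → ∀ n → num a n ≤ den a n
num≤den a₀≥1 zero = z≤n
num≤den {a} a₀≥1 (suc n) rewrite num-suc a n | den-suc a n = begin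
  den (tail a) n                           ≡⟨ *-identityˡ (den (tail a) n) ⟨
  1 * den (tail a) n                       ≤⟨ *-monoˡ-≤ (den (tail a) n) a₀≥1 ⟩
  a 0 * den (tail a) n                     ≤⟨ m≤m+n _ _ ⟩
  a 0 * den (tail a) n + num (tail a) n    ∎
  where open ≤-Reasoning

_≤[_]_ : Digits → ℕ → Digits → Set
b ≤[ n ] a = num b n * den a n ≤ num a n * den b n

head<⇒≤[suc] : ∀ {a b} n → a 0 < b 0 → 1 ≤ a 1 → b ≤[ suc n ] a
head<⇒≤[suc] {a} {b} n a₀<b₀ a₁≥1
  rewrite num-suc a n | den-suc a n | num-suc b n | den-suc b n = begin
  D′ * (a 0 * D + N)        ≤⟨ *-monoʳ-≤ D′ (+-monoʳ-≤ (a 0 * D) (num≤den a₁≥1 n)) ⟩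
  D′ * (a 0 * D + D)        ≡⟨ regroup (a 0) D D′ ⟩
  suc (a 0) * D * D′        ≤⟨ *-monoˡ-≤ D′ (*-monoˡ-≤ D a₀<b₀) ⟩
  b 0 * D * D′              ≡⟨ swap (b 0) D D′ ⟩
  D * (b 0 * D′)            ≤⟨ m≤m+n _ _ ⟩
  D * (b 0 * D′) + D * N′   ≡⟨ *-distribˡ-+ D (b 0 * D′) N′ ⟨
  D * (b 0 * D′ + N′)       ∎
  where
  open ≤-Reasoning
  D N D′ N′ : ℕ
  D = den (tail a) n
  N = num (tail a) n
  D′ = den (tail b) n
  N′ = num (tail b) n
  regroup : ∀ x D D′ → D′ * (x * D + D) ≡ suc x * D * D′
  regroup = solve-∀
  swap : ∀ x D D′ → x * D * D′ ≡ D * (x * D′)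
  swap = solve-∀

head≡⇒≤[suc] : ∀ {a b} n → a 0 ≡ b 0 → tail a ≤[ n ] tail b → b ≤[ suc n ] a
head≡⇒≤[suc] {a} {b} n a₀≡b₀ tails≤
  rewrite num-suc a n | den-suc a n | num-suc b n | den-suc b n | a₀≡b₀ = begin
  D′ * (b 0 * D + N)       ≡⟨ expand (b 0) D N D′ ⟩
  b 0 * D * D′ + N * D′    ≤⟨ +-monoʳ-≤ (b 0 * D * D′) tails≤ ⟩
  b 0 * D * D′ + N′ * D    ≡⟨ collect (b 0) D N′ D′ ⟩
  D * (b 0 * D′ + N′)      ∎
  where
  open ≤-Reasoning
  D N D′ N′ : ℕ
  D = den (tail a) n
  N = num (tail a) n
  D′ = den (tail b) n
  N′ = num (tail b) n
  expand : ∀ x D N D′ → D′ * (x * D + N) ≡ x * D * D′ + N * D′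
  expand = solve-∀
  collect : ∀ x D N′ D′ → x * D * D′ + N′ * D ≡ D * (x * D′ + N′)
  collect = solve-∀

OnlyOnesTwos-tail : ∀ {a} → OnlyOnesTwos a → OnlyOnesTwos (tail a)
OnlyOnesTwos-tail ok i = ok (suc i)

¬Contains2121-tail : ∀ {a} → ¬ Contains2121 a → ¬ Contains2121 (tail a)
¬Contains2121-tail ¬2121 (i , block) = ¬2121 (suc i , block)

1≤digit : ∀ {x} → x ≡ 1 ⊎ x ≡ 2 → 1 ≤ x
1≤digit (inj₁ refl) = s≤s z≤n
1≤digit (inj₂ refl) = s≤s z≤n

mutual
  w₀≤ : ∀ n a → OnlyOnesTwos a → ¬ Contains2121 a → w₀ ≤[ n ] a
  w₀≤ zero a ok ¬2121 = z≤n
  w₀≤ (suc n) a ok ¬2121 with ok 0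
  ... | inj₁ a₀≡1 = head<⇒≤[suc] n (≤-reflexive (cong suc a₀≡1)) (1≤digit (ok 1))
  ... | inj₂ a₀≡2 = head≡⇒≤[suc] n a₀≡2 (≤w₀-after-2 n a ok ¬2121 a₀≡2)

  ≤w₀-after-2 : ∀ n a → OnlyOnesTwos a → ¬ Contains2121 a →
    a 0 ≡ 2 → tail a ≤[ n ] tail w₀
  ≤w₀-after-2 zero a ok ¬2121 a₀≡2 = z≤n
  ≤w₀-after-2 (suc n) a ok ¬2121 a₀≡2 with ok 1
  ... | inj₂ a₁≡2 = head<⇒≤[suc] n (≤-reflexive (sym a₁≡2)) (s≤s z≤n)
  ... | inj₁ a₁≡1 = head≡⇒≤[suc] n (sym a₁≡1) (w₀≤-after-21 n a ok ¬2121 a₀≡2 a₁≡1)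

  w₀≤-after-21 : ∀ n a → OnlyOnesTwos a → ¬ Contains2121 a →
    a 0 ≡ 2 → a 1 ≡ 1 → tail (tail w₀) ≤[ n ] tail (tail a)
  w₀≤-after-21 zero a ok ¬2121 a₀≡2 a₁≡1 = z≤n
  w₀≤-after-21 (suc n) a ok ¬2121 a₀≡2 a₁≡1 with ok 2
  ... | inj₁ a₂≡1 = head<⇒≤[suc] n (≤-reflexive (cong suc a₂≡1)) (1≤digit (ok 3))
  ... | inj₂ a₂≡2 = head≡⇒≤[suc] n a₂≡2 (≤w₀-after-212 n a ok ¬2121 a₀≡2 a₁≡1 a₂≡2)

  ≤w₀-after-212 : ∀ n a → OnlyOnesTwos a → ¬ Contains2121 a →
    a 0 ≡ 2 → a 1 ≡ 1 → a 2 ≡ 2 → tail (tail (tail a)) ≤[ n ] tail (tail (tail w₀))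
  ≤w₀-after-212 zero a ok ¬2121 a₀≡2 a₁≡1 a₂≡2 = z≤n
  ≤w₀-after-212 (suc n) a ok ¬2121 a₀≡2 a₁≡1 a₂≡2 with ok 3
  ... | inj₁ a₃≡1 = contradiction (0 , a₀≡2 , a₁≡1 , a₂≡2 , a₃≡1) ¬2121
  -- Four tails of w₀ are definitionally w₀: the builtin _%_ reduces
  -- (4 + i) % 4 to i % 4.
  ... | inj₂ a₃≡2 = head≡⇒≤[suc] n (sym a₃≡2)
        (w₀≤ n (tail (tail (tail (tail a))))
          ((OnlyOnesTwos-tail ∘ OnlyOnesTwos-tail ∘ OnlyOnesTwos-tail ∘ OnlyOnesTwos-tail) ok)
          ((¬Contains2121-tail ∘ ¬Contains2121-tail ∘ ¬Contains2121-tail ∘ ¬Contains2121-tail) ¬2121))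

≤[]⇒≥ᶜᶠ : ∀ {a b} → (∀ n → b ≤[ n ] a) → a ≥ᶜᶠ b
≤[]⇒≥ᶜᶠ {a} {b} b≤a k = 0 , λ n _ → begin
  num b n * den a n * suc k                     ≤⟨ *-monoˡ-≤ (suc k) (b≤a n) ⟩
  num a n * den b n * suc k                     ≡⟨ xy∙z≈xz∙y (num a n) (den b n) (suc k) ⟩
  num a n * suc k * den b n                     ≤⟨ m≤m+n _ _ ⟩
  num a n * suc k * den b n + den a n * den b n ≡⟨ *-distribʳ-+ (den b n) (num a n * suc k) (den a n) ⟨
  (num a n * suc k + den a n) * den b n         ∎
  where open ≤-Reasoning

lemma11 : (a : Digits) → OnlyOnesTwos a → ¬ Contains2121 a → a ≥ᶜᶠ w₀
lemma11 a ok ¬2121 = ≤[]⇒≥ᶜᶠ (λ n → w₀≤ n a ok ¬2121)
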